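{- Let $R$ be a finite commutative local ring with unity and $x$ a nonzero element of $R$. Let $R^*$ be the units of $R$, $xR^*=\{xr : r \in R^*\}$, $I_x$ the ideal generated by $x$, and $M_x = I_x\setminus xR^*$. Then the adjacency spectrum of $\mathrm{Cay}(I_x, xR^*)$ is: eigenvalue $|xR^*|$ with multiplicity $1$, eigenvalue $-|M_x|$ with multiplicity $\frac{|I_x|}{|M_x|} - 1$, and eigenvalue $0$ with multiplicity $\frac{|I_x|}{|M_x|}(|M_x| - 1)$.
   Context: $\mathrm{Cay}(I_x, xR^*)$ is the graph with vertex set $I_x$ in which $u, v$ are adjacent iff $u-v\in xR^*$. Eigenvalues of a graph are the eigenvalues of its $(0,1)$-adjacency matrix. -}

module Defs where

open import Level using (0ℓ)
open import Algebra.Bundles using (CommutativeRing)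
open import Data.Nat as ℕ using (ℕ; zero; suc)
open import Data.Fin using (Fin; zero; suc; punchIn)
open import Data.Integer as ℤ using (ℤ; +_; -_)
open import Data.Product using (Σ; ∃; _×_; _,_)
open import Data.Sum using (_⊎_)
open import Relation.Nullary using (¬_)
open import Relation.Unary using (Pred; _⊆_)
open import Relation.Binary.PropositionalEquality using (_≡_)

Matrix : ℕ → Set
Matrix n = Fin n → Fin n → ℤ

sumFin : ∀ n → (Fin n → ℤ) → ℤ
sumFin zero    f = + 0
sumFin (suc n) f = f zero ℤ.+ sumFin n (λ i → f (suc i))

signFin : ∀ {n} → Fin n → ℤ
signFin zero    = + 1
signFin (suc j) = - signFin j

minor : ∀ {n} → Matrix (suc n) → Fin (suc n) → Matrix n
minor M j i k = M (suc i) (punchIn j k)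

det : ∀ n → Matrix n → ℤ
det zero    M = + 1
det (suc n) M = sumFin (suc n) (λ j → signFin j ℤ.* (M zero j ℤ.* det n (minor M j)))

-- t·I − A
charMatrix : ∀ {n} → ℤ → Matrix n → Matrix n
charMatrix {suc n} t A zero    zero    = t ℤ.- A zero zero
charMatrix {suc n} t A zero    (suc k) = - A zero (suc k)
charMatrix {suc n} t A (suc i) zero    = - A (suc i) zero
charMatrix {suc n} t A (suc i) (suc k) = charMatrix {n} t (λ i' k' → A (suc i') (suc k')) i k

charPoly : ∀ n → Matrix n → ℤ → ℤ
charPoly n A t = det n (charMatrix t A)

IsAdjacencyMatrix : ∀ {n} → (Fin n → Fin n → Set) → Matrix n → Set
IsAdjacencyMatrix {n} Adj A =
  ∀ i j → (A i j ≡ + 1 × Adj i j) ⊎ (A i j ≡ + 0 × ¬ Adj i j)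

module _ (R : CommutativeRing 0ℓ 0ℓ) where
  open CommutativeRing R

  record Enumerates (P : Pred Carrier 0ℓ) {n : ℕ} (e : Fin n → Carrier) : Set where
    field
      inP       : ∀ i → P (e i)
      injective : ∀ i j → e i ≈ e j → i ≡ j
      surjective : ∀ y → P y → ∃ λ i → e i ≈ y

  Everything : Pred Carrier 0ℓ
  Everything _ = Data.Unit.⊤
    where import Data.Unit

  IsFiniteRing : Set
  IsFiniteRing = Σ ℕ λ n → Σ (Fin n → Carrier) λ e → Enumerates Everything e

  record IsIdeal (I : Pred Carrier 0ℓ) : Set where
    field
      resp  : ∀ {a b} → a ≈ b → I a → I b
      zero∈ : I 0#
      +-closed : ∀ {a b} → I a → I b → I (a + b)
      *-closed : ∀ r {a} → I a → I (r * a)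

  IsProper : Pred Carrier 0ℓ → Set
  IsProper I = ¬ I 1#

  IsMaximalIdeal : Pred Carrier 0ℓ → Set₁
  IsMaximalIdeal M = IsIdeal M × IsProper M ×
    (∀ (J : Pred Carrier 0ℓ) → IsIdeal J → IsProper J → M ⊆ J → J ⊆ M)

  IsLocalRing : Set₁
  IsLocalRing = Σ (Pred Carrier 0ℓ) λ M → IsMaximalIdeal M ×
    (∀ N → IsMaximalIdeal N → (N ⊆ M × M ⊆ N))

  IsUnit : Pred Carrier 0ℓ
  IsUnit r = ∃ λ s → r * s ≈ 1#

  xR* : Carrier → Pred Carrier 0ℓ
  xR* x y = ∃ λ r → IsUnit r × y ≈ x * r

  Ix : Carrier → Pred Carrier 0ℓ
  Ix x y = ∃ λ r → y ≈ x * r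

  Mx : Carrier → Pred Carrier 0ℓ
  Mx x y = Ix x y × ¬ xR* x y

  CayAdj : Carrier → Carrier → Carrier → Set
  CayAdj x u v = xR* x (u - v)

{-# OPTIONS --safe #-}
module Submission where

open import Defs
open import Level using (0ℓ)
open import Algebra.Bundles using (CommutativeRing)
open import Data.Nat as ℕ using (ℕ; _∸_)
open import Data.Fin using (Fin)
open import Data.Integer as ℤ using (ℤ; +_)
open import Data.Product using (Σ; _×_)
open import Relation.Nullary using (¬_)
open import Relation.Binary.PropositionalEquality using (_≡_)

-- In a finite local ring the nonunits form the maximal ideal (saturating r R over the ring
-- yields a maximal ideal containing a nonunit r), and since x ≉ 0, x r ≈ x u with u a unit
-- forces r to be a unit. Hence M_x is an additive subgroup of I_x, non-adjacency in
-- Cay(I_x, xR*) is congruence modulo M_x, and the graph is complete multipartite with q parts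
-- of size b = |M_x|: tI - A = tI + S - J with S the indicator matrix of the partition.
-- Generalising to det (tI + (S + βJ) diag w), induction on the size works: if 0 has a
-- class-mate p, one row and one column operation split off a factor t and add the weight of
-- 0 to p; if 0 is alone in its class, linearity in row 0 gives the recurrence of
-- (t + b)^(q-1) (t + b + βqb). At β = -1 and w = 1 this is (t - (m - b)) (t + b)^(q-1) t^(m-q).

module Determinant where
  open import Data.Nat using (zero; suc)
  open import Data.Fin using (zero; suc; punchIn)
  open import Data.Fin.Properties using (punchInᵢ≢i; suc-injective)
  open import Data.Integer using (-_; _+_; _*_)
  open import Data.Integer.Properties
    using (+-*-semiring; +-0-abelianGroup; +-identityˡ; +-identityʳ; *-identityˡ; *-zeroˡ; *-zeroʳ; +-comm)
  open import Algebra.Properties.AbelianGroup +-0-abelianGroup using (inverseʳ-unique)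
  open import Function using (_∘_)
  open import Relation.Nullary using (contradiction)
  open import Data.Integer.Tactic.RingSolver using (solve-∀)
  open import Algebra.Properties.Semiring.Sum +-*-semiring
    using (sum; sum-syntax; sum-cong-≗; ∑-distrib-+; ∑-comm; *-distribˡ-sum; sum-remove; sum-replicate-zero)
    public
  open import Relation.Binary.PropositionalEquality
  open ≡-Reasoning

  sumFin≡sum : ∀ n (f : Fin n → ℤ) → sumFin n f ≡ sum f
  sumFin≡sum zero    f = refl
  sumFin≡sum (suc n) f = cong (_+_ (f zero)) (sumFin≡sum n (λ i → f (suc i)))

  sum-zero : ∀ {n} {f : Fin n → ℤ} → (∀ i → f i ≡ + 0) → sum f ≡ + 0
  sum-zero {n} f≗0 = trans (sum-cong-≗ f≗0) (sum-replicate-zero n)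

  sum-single : ∀ {n} (f : Fin n → ℤ) i → (∀ j → j ≢ i → f j ≡ + 0) → sum f ≡ f i
  sum-single {suc n} f i f≗0 = begin
    sum f                                  ≡⟨ sum-remove f ⟩
    f i + sum (λ k → f (punchIn i k))      ≡⟨ cong (_+_ (f i)) (sum-zero (λ k → f≗0 _ (punchInᵢ≢i i k))) ⟩
    f i + + 0                              ≡⟨ +-identityʳ (f i) ⟩
    f i                                    ∎

  transpose : ∀ {n} → Matrix n → Matrix n
  transpose M i j = M j i

  minorᶜ : ∀ {n} → Matrix (suc n) → Fin (suc n) → Matrix n
  minorᶜ M i k j = M (punchIn i k) (suc j)

  laplaceTerm : ∀ {n} → Matrix (suc n) → Fin (suc n) → ℤ
  laplaceTerm {n} M j = signFin j * (M zero j * det n (minor M j))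

  det-expand : ∀ n (M : Matrix (suc n)) → det (suc n) M ≡ sum (laplaceTerm M)
  det-expand n M = sumFin≡sum (suc n) (laplaceTerm M)

  det-linear-terms : ∀ n (A B C : Matrix (suc n)) c →
    (∀ j → laplaceTerm C j ≡ c * laplaceTerm A j + laplaceTerm B j) →
    det (suc n) C ≡ c * det (suc n) A + det (suc n) B
  det-linear-terms n A B C c terms = begin
    det (suc n) C
      ≡⟨ det-expand n C ⟩
    sum (laplaceTerm C)
      ≡⟨ sum-cong-≗ terms ⟩
    sum (λ j → c * laplaceTerm A j + laplaceTerm B j)
      ≡⟨ ∑-distrib-+ (λ j → c * laplaceTerm A j) (laplaceTerm B) ⟩
    sum (λ j → c * laplaceTerm A j) + sum (laplaceTerm B)
      ≡⟨ cong₂ _+_ (*-distribˡ-sum c (laplaceTerm A)) (det-expand n B) ⟨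
    c * sum (laplaceTerm A) + det (suc n) B
      ≡⟨ cong (λ d → c * d + det (suc n) B) (det-expand n A) ⟨
    c * det (suc n) A + det (suc n) B
      ∎

  det-cong-minors : ∀ n {M N : Matrix (suc n)} → M zero ≗ N zero →
    (∀ j → det n (minor M j) ≡ det n (minor N j)) → det (suc n) M ≡ det (suc n) N
  det-cong-minors n {M} {N} row₀ minors = begin
    det (suc n) M
      ≡⟨ det-expand n M ⟩
    sum (laplaceTerm M)
      ≡⟨ sum-cong-≗ {suc n} (λ j → cong₂ (λ a d → signFin j * (a * d)) (row₀ j) (minors j)) ⟩
    sum (laplaceTerm N)
      ≡⟨ det-expand n N ⟨
    det (suc n) N
      ∎

  det-cong : ∀ n {M N : Matrix n} → (∀ i j → M i j ≡ N i j) → det n M ≡ det n N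
  det-cong zero    M≈N = refl
  det-cong (suc n) {M} {N} M≈N =
    det-cong-minors n {M} {N} (M≈N zero) (λ j → det-cong n (λ i k → M≈N (suc i) (punchIn j k)))

  laplaceTerm-zeroEntry : ∀ {n} (M : Matrix (suc n)) j → M zero j ≡ + 0 → laplaceTerm M j ≡ + 0
  laplaceTerm-zeroEntry {n} M j entry = begin
    signFin j * (M zero j * det n (minor M j)) ≡⟨ cong (λ a → signFin j * (a * det n (minor M j))) entry ⟩
    signFin j * (+ 0 * det n (minor M j))      ≡⟨ cong (signFin j *_) (*-zeroˡ (det n (minor M j))) ⟩
    signFin j * + 0                            ≡⟨ *-zeroʳ (signFin j) ⟩
    + 0                                        ∎

  laplaceTerm-zeroMinor : ∀ {n} (M : Matrix (suc n)) j → det n (minor M j) ≡ + 0 → laplaceTerm M j ≡ + 0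
  laplaceTerm-zeroMinor {n} M j minor≡0 = begin
    signFin j * (M zero j * det n (minor M j)) ≡⟨ cong (λ d → signFin j * (M zero j * d)) minor≡0 ⟩
    signFin j * (M zero j * + 0)               ≡⟨ cong (signFin j *_) (*-zeroʳ (M zero j)) ⟩
    signFin j * + 0                            ≡⟨ *-zeroʳ (signFin j) ⟩
    + 0                                        ∎

  det-minors-zero : ∀ n (M : Matrix (suc n)) → (∀ j → det n (minor M j) ≡ + 0) → det (suc n) M ≡ + 0
  det-minors-zero n M minors = trans (det-expand n M) (sum-zero {suc n} (λ j → laplaceTerm-zeroMinor M j (minors j)))

  -- Expand each minor along row 0 in turn along its column 0 and exchange the two sums.
  det-expandCol₀ : ∀ n (M : Matrix (suc n)) →
    det (suc n) M ≡ ∑[ i < suc n ] (signFin i * (M i zero * det n (minorᶜ M i)))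
  det-expandCol₀ zero    M = refl
  det-expandCol₀ (suc n) M =
    trans (det-expand (suc n) M) (cong (_+_ (laplaceTerm M zero)) exchange)
    where
    column summand : Fin (suc n) → Fin (suc n) → ℤ
    column  j i = signFin i * (M (suc i) zero * det n (minor (minorᶜ M (suc i)) j))
    summand j i = - signFin j * (M zero (suc j) * column j i)

    pull : ∀ {k} c d (f : Fin k → ℤ) → c * (d * sum f) ≡ sum (λ i → c * (d * f i))
    pull c d f = trans (cong (c *_) (*-distribˡ-sum d f)) (*-distribˡ-sum c (λ i → d * f i))

    reorder : ∀ sj si a b D → - sj * (a * (si * (b * D))) ≡ - si * (b * (sj * (a * D)))
    reorder = solve-∀

    exchange : ∑[ j < suc n ] (- signFin j * (M zero (suc j) * det (suc n) (minor M (suc j))))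
             ≡ ∑[ i < suc n ] (- signFin i * (M (suc i) zero * det (suc n) (minorᶜ M (suc i))))
    exchange = begin
      ∑[ j < suc n ] (- signFin j * (M zero (suc j) * det (suc n) (minor M (suc j))))
        ≡⟨ sum-cong-≗ (λ j → cong (λ d → - signFin j * (M zero (suc j) * d))
                                   (det-expandCol₀ n (minor M (suc j)))) ⟩
      ∑[ j < suc n ] (- signFin j * (M zero (suc j) * ∑[ i < suc n ] column j i))
        ≡⟨ sum-cong-≗ (λ j → pull (- signFin j) (M zero (suc j)) (column j)) ⟩
      ∑[ j < suc n ] ∑[ i < suc n ] summand j i
        ≡⟨ ∑-comm summand ⟩
      ∑[ i < suc n ] ∑[ j < suc n ] summand j i
        ≡⟨ sum-cong-≗ (λ i → sum-cong-≗ {suc n} (λ j →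
             reorder (signFin j) (signFin i) (M zero (suc j)) (M (suc i) zero) (det n (minor (minorᶜ M (suc i)) j)))) ⟩
      ∑[ i < suc n ] ∑[ j < suc n ] (- signFin i * (M (suc i) zero * laplaceTerm (minorᶜ M (suc i)) j))
        ≡⟨ sum-cong-≗ (λ i → pull (- signFin i) (M (suc i) zero) (laplaceTerm (minorᶜ M (suc i)))) ⟨
      ∑[ i < suc n ] (- signFin i * (M (suc i) zero * sum (laplaceTerm (minorᶜ M (suc i)))))
        ≡⟨ sum-cong-≗ (λ i → cong (λ d → - signFin i * (M (suc i) zero * d)) (det-expand n (minorᶜ M (suc i)))) ⟨
      ∑[ i < suc n ] (- signFin i * (M (suc i) zero * det (suc n) (minorᶜ M (suc i))))
        ∎

  det-transpose : ∀ n (M : Matrix n) → det n (transpose M) ≡ det n M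
  det-transpose zero    M = refl
  det-transpose (suc n) M = begin
    det (suc n) (transpose M)
      ≡⟨ det-expand n (transpose M) ⟩
    sum (laplaceTerm (transpose M))
      ≡⟨ sum-cong-≗ (λ i → cong (λ d → signFin i * (M i zero * d)) (det-transpose n (minorᶜ M i))) ⟩
    ∑[ i < suc n ] (signFin i * (M i zero * det n (minorᶜ M i)))
      ≡⟨ det-expandCol₀ n M ⟨
    det (suc n) M
      ∎

  det-linearRow : ∀ n (A B C : Matrix n) (r : Fin n) c →
    (∀ i → i ≢ r → A i ≗ C i) → (∀ i → i ≢ r → B i ≗ C i) →
    (∀ j → C r j ≡ c * A r j + B r j) → det n C ≡ c * det n A + det n B
  det-linearRow (suc n) A B C zero c A≈C B≈C Cr = det-linear-terms n A B C c λ j → begin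
    signFin j * (C zero j * det n (minor C j))
      ≡⟨ cong (λ a → signFin j * (a * det n (minor C j))) (Cr j) ⟩
    signFin j * ((c * A zero j + B zero j) * det n (minor C j))
      ≡⟨ expand (signFin j) c (A zero j) (B zero j) (det n (minor C j)) ⟩
    c * (signFin j * (A zero j * det n (minor C j))) + signFin j * (B zero j * det n (minor C j))
      ≡⟨ cong₂ (λ dA dB → c * (signFin j * (A zero j * dA)) + signFin j * (B zero j * dB))
               (det-cong n (λ i k → A≈C (suc i) (λ ()) (punchIn j k)))
               (det-cong n (λ i k → B≈C (suc i) (λ ()) (punchIn j k))) ⟨
    c * laplaceTerm A j + laplaceTerm B j
      ∎
    where
    expand : ∀ s c a b d → s * ((c * a + b) * d) ≡ c * (s * (a * d)) + s * (b * d)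
    expand = solve-∀
  det-linearRow (suc n) A B C (suc r) c A≈C B≈C Cr = det-linear-terms n A B C c λ j → begin
    signFin j * (C zero j * det n (minor C j))
      ≡⟨ cong (λ d → signFin j * (C zero j * d))
              (det-linearRow n (minor A j) (minor B j) (minor C j) r c
                 (λ i i≢r k → A≈C (suc i) (i≢r ∘ suc-injective) (punchIn j k))
                 (λ i i≢r k → B≈C (suc i) (i≢r ∘ suc-injective) (punchIn j k))
                 (λ k → Cr (punchIn j k))) ⟩
    signFin j * (C zero j * (c * det n (minor A j) + det n (minor B j)))
      ≡⟨ expand (signFin j) c (C zero j) (det n (minor A j)) (det n (minor B j)) ⟩
    c * (signFin j * (C zero j * det n (minor A j))) + signFin j * (C zero j * det n (minor B j))
      ≡⟨ cong₂ (λ a b → c * (signFin j * (a * det n (minor A j))) + signFin j * (b * det n (minor B j)))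
               (A≈C zero (λ ()) j) (B≈C zero (λ ()) j) ⟨
    c * laplaceTerm A j + laplaceTerm B j
      ∎
    where
    expand : ∀ s c a dA dB → s * (a * (c * dA + dB)) ≡ c * (s * (a * dA)) + s * (a * dB)
    expand = solve-∀

  -- The terms of columns 0 and 1 cancel; every other minor again has two equal columns.
  det-equalCols₀₁ : ∀ n (M : Matrix (suc (suc n))) → (∀ i → M i zero ≡ M i (suc zero)) →
    det (suc (suc n)) M ≡ + 0
  det-equalCols₀₁ n M cols = begin
    det (suc (suc n)) M
      ≡⟨ det-expand (suc n) M ⟩
    laplaceTerm M zero + (laplaceTerm M (suc zero) + ∑[ j < n ] laplaceTerm M (suc (suc j)))
      ≡⟨ cong₂ (λ t rest → laplaceTerm M zero + (t + rest)) cancel (sum-zero {n} (rest≡0 M cols)) ⟩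
    laplaceTerm M zero + (- laplaceTerm M zero + + 0)
      ≡⟨ x-x≡0 (laplaceTerm M zero) ⟩
    + 0
      ∎
    where
    x-x≡0 : ∀ x → x + (- x + + 0) ≡ + 0
    x-x≡0 = solve-∀
    -1* : ∀ x → - (+ 1) * x ≡ - (+ 1 * x)
    -1* = solve-∀
    cancel : laplaceTerm M (suc zero) ≡ - laplaceTerm M zero
    cancel = begin
      - (+ 1) * (M zero (suc zero) * det (suc n) (minor M (suc zero)))
        ≡⟨ cong₂ (λ a d → - (+ 1) * (a * d)) (cols zero)
                 (det-cong (suc n) {minor M zero} {minor M (suc zero)}
                    (λ i → λ { zero → sym (cols (suc i)) ; (suc k) → refl })) ⟨
      - (+ 1) * (M zero zero * det (suc n) (minor M zero))
        ≡⟨ -1* _ ⟩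
      - laplaceTerm M zero
        ∎
    rest≡0 : ∀ {k} (N : Matrix (suc (suc k))) → (∀ i → N i zero ≡ N i (suc zero)) →
             ∀ j → laplaceTerm N (suc (suc j)) ≡ + 0
    rest≡0 {suc k} N colsN j = laplaceTerm-zeroMinor N (suc (suc j))
      (det-equalCols₀₁ k (minor N (suc (suc j))) (λ i → colsN (suc i)))

  det-equalRows₀₁ : ∀ n (M : Matrix (suc (suc n))) → M zero ≗ M (suc zero) → det (suc (suc n)) M ≡ + 0
  det-equalRows₀₁ n M rows = trans (sym (det-transpose _ M)) (det-equalCols₀₁ n (transpose M) rows)

  setRows₀₁ : ∀ {n} (u v : Fin (suc (suc n)) → ℤ) → Matrix (suc (suc n)) → Matrix (suc (suc n))
  setRows₀₁ u v M zero          = u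
  setRows₀₁ u v M (suc zero)    = v
  setRows₀₁ u v M (suc (suc i)) = M (suc (suc i))

  setRows₀₁-self : ∀ {n} (M : Matrix (suc (suc n))) i j → setRows₀₁ (M zero) (M (suc zero)) M i j ≡ M i j
  setRows₀₁-self M zero          j = refl
  setRows₀₁-self M (suc zero)    j = refl
  setRows₀₁-self M (suc (suc i)) j = refl

  module _ {n} (M : Matrix (suc (suc n))) where

    private
      D : (u v : Fin (suc (suc n)) → ℤ) → ℤ
      D u v = det (suc (suc n)) (setRows₀₁ u v M)

      _⊕_ : (u v : Fin (suc (suc n)) → ℤ) → Fin (suc (suc n)) → ℤ
      (u ⊕ v) j = u j + v j

      1*u+v : ∀ (u v : Fin (suc (suc n)) → ℤ) j → u j + v j ≡ + 1 * u j + v j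
      1*u+v u v j = cong (_+ v j) (sym (*-identityˡ (u j)))

      additive₀ : ∀ u v w → D (u ⊕ v) w ≡ D u w + D v w
      additive₀ u v w = trans
        (det-linearRow _ (setRows₀₁ u w M) (setRows₀₁ v w M) (setRows₀₁ (u ⊕ v) w M) zero (+ 1)
          (λ { zero 0≢0 → contradiction refl 0≢0 ; (suc zero) _ _ → refl ; (suc (suc i)) _ _ → refl })
          (λ { zero 0≢0 → contradiction refl 0≢0 ; (suc zero) _ _ → refl ; (suc (suc i)) _ _ → refl })
          (1*u+v u v))
        (cong (_+ D v w) (*-identityˡ (D u w)))

      additive₁ : ∀ u v w → D w (u ⊕ v) ≡ D w u + D w v
      additive₁ u v w = trans
        (det-linearRow _ (setRows₀₁ w u M) (setRows₀₁ w v M) (setRows₀₁ w (u ⊕ v) M) (suc zero) (+ 1)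
          (λ { zero _ _ → refl ; (suc zero) 1≢1 → contradiction refl 1≢1 ; (suc (suc i)) _ _ → refl })
          (λ { zero _ _ → refl ; (suc zero) 1≢1 → contradiction refl 1≢1 ; (suc (suc i)) _ _ → refl })
          (1*u+v u v))
        (cong (_+ D w v) (*-identityˡ (D w u)))

      alternating : ∀ u → D u u ≡ + 0
      alternating u = det-equalRows₀₁ n (setRows₀₁ u u M) (λ _ → refl)

    -- Expand D (u ⊕ v) (u ⊕ v) = 0 bilinearly.
    det-swapRows₀₁ : ∀ u v → D v u ≡ - D u v
    det-swapRows₀₁ u v = inverseʳ-unique (D u v) (D v u) (begin
      D u v + D v u
        ≡⟨ cong₂ _+_ (+-identityˡ (D u v)) (+-identityʳ (D v u)) ⟨
      (+ 0 + D u v) + (D v u + + 0)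
        ≡⟨ cong₂ (λ x y → (x + D u v) + (D v u + y)) (alternating u) (alternating v) ⟨
      (D u u + D u v) + (D v u + D v v)
        ≡⟨ cong₂ _+_ (additive₁ u v u) (additive₁ u v v) ⟨
      D u (u ⊕ v) + D v (u ⊕ v)
        ≡⟨ additive₀ u v (u ⊕ v) ⟨
      D (u ⊕ v) (u ⊕ v)
        ≡⟨ alternating (u ⊕ v) ⟩
      + 0
        ∎)

  det-equalRows₀ : ∀ n (M : Matrix (suc n)) (p : Fin n) → M zero ≗ M (suc p) → det (suc n) M ≡ + 0
  det-equalRows₀ (suc n) M zero    rows = det-equalRows₀₁ n M rows
  det-equalRows₀ (suc n) M (suc p) rows = begin
    det (suc (suc n)) M
      ≡⟨ det-cong _ (setRows₀₁-self M) ⟨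
    det (suc (suc n)) (setRows₀₁ (M zero) (M (suc zero)) M)
      ≡⟨ det-swapRows₀₁ M (M (suc zero)) (M zero) ⟩
    - det (suc (suc n)) swapped
      ≡⟨ cong -_ (det-minors-zero (suc n) swapped
                   (λ j → det-equalRows₀ n (minor swapped j) p (λ k → rows (punchIn j k)))) ⟩
    + 0
      ∎
    where
    swapped = setRows₀₁ (M (suc zero)) (M zero) M

  addRow₀Multiples : ∀ {n} → (Fin n → ℤ) → Matrix (suc n) → Matrix (suc n)
  addRow₀Multiples c M zero      j = M zero j
  addRow₀Multiples c M (suc i)   j = M (suc i) j + c i * M zero j

  -- Swapping rows 0 and 1 turns the multiples of row 0 added to the rows below row 1 into
  -- multiples of row 0 of each minor, so induction applies.
  det-addRow₀Multiples : ∀ n (c : Fin n → ℤ) (M : Matrix (suc n)) →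
    det (suc n) (addRow₀Multiples c M) ≡ det (suc n) M
  det-addRow₀Multiples zero    c M = det-cong 1 {addRow₀Multiples c M} {M} (λ { zero j → refl })
  det-addRow₀Multiples (suc n) c M = begin
    det _ M⁺
      ≡⟨ det-cong _ (setRows₀₁-self M⁺) ⟨
    det _ (setRows₀₁ (M zero) (M⁺ (suc zero)) M⁺)
      ≡⟨ det-swapRows₀₁ M⁺ (M⁺ (suc zero)) (M zero) ⟩
    - det _ (setRows₀₁ (M⁺ (suc zero)) (M zero) M⁺)
      ≡⟨ cong -_ (det-linearRow _ (setRows₀₁ (M zero) (M zero) M⁺) (setRows₀₁ (M (suc zero)) (M zero) M⁺)
                   (setRows₀₁ (M⁺ (suc zero)) (M zero) M⁺) zero (c zero)
                   (λ { zero 0≢0 → contradiction refl 0≢0 ; (suc zero) _ _ → refl ; (suc (suc i)) _ _ → refl })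
                   (λ { zero 0≢0 → contradiction refl 0≢0 ; (suc zero) _ _ → refl ; (suc (suc i)) _ _ → refl })
                   (λ j → +-comm (M (suc zero) j) (c zero * M zero j))) ⟩
    - (c zero * det _ (setRows₀₁ (M zero) (M zero) M⁺) + det _ (setRows₀₁ (M (suc zero)) (M zero) M⁺))
      ≡⟨ cong₂ (λ d d′ → - (c zero * d + d′))
               (det-equalRows₀₁ n (setRows₀₁ (M zero) (M zero) M⁺) (λ _ → refl))
               (det-cong-minors (suc n) {setRows₀₁ (M (suc zero)) (M zero) M⁺} {swapped} (λ _ → refl) minors) ⟩
    - (c zero * + 0 + det _ swapped)
      ≡⟨ cong (λ d → - (c zero * + 0 + d)) (det-swapRows₀₁ M (M zero) (M (suc zero))) ⟩
    - (c zero * + 0 + - det _ (setRows₀₁ (M zero) (M (suc zero)) M))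
      ≡⟨ cong (λ d → - (c zero * + 0 + - d)) (det-cong _ (setRows₀₁-self M)) ⟩
    - (c zero * + 0 + - det _ M)
      ≡⟨ simplify (c zero) (det _ M) ⟩
    det _ M
      ∎
    where
    M⁺ = addRow₀Multiples c M
    swapped = setRows₀₁ (M (suc zero)) (M zero) M
    minors : ∀ j → det (suc n) (minor (setRows₀₁ (M (suc zero)) (M zero) M⁺) j) ≡ det (suc n) (minor swapped j)
    minors j = trans
      (det-cong (suc n) {minor (setRows₀₁ (M (suc zero)) (M zero) M⁺) j}
                        {addRow₀Multiples (λ i → c (suc i)) (minor swapped j)}
                        (λ { zero k → refl ; (suc i) k → refl }))
      (det-addRow₀Multiples n (λ i → c (suc i)) (minor swapped j))
    simplify : ∀ x d → - (x * + 0 + - d) ≡ d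
    simplify = solve-∀

  det-addRowToRow₀ : ∀ n (M N : Matrix (suc n)) (p : Fin n) c →
    (∀ i → N (suc i) ≗ M (suc i)) → (∀ j → N zero j ≡ M zero j + c * M (suc p) j) →
    det (suc n) N ≡ det (suc n) M
  det-addRowToRow₀ n M N p c rows row₀ = begin
    det (suc n) N
      ≡⟨ det-linearRow (suc n) A M N zero c
           (λ { zero 0≢0 → contradiction refl 0≢0 ; (suc i) _ j → sym (rows i j) })
           (λ { zero 0≢0 → contradiction refl 0≢0 ; (suc i) _ j → sym (rows i j) })
           (λ j → trans (row₀ j) (+-comm (M zero j) (c * M (suc p) j))) ⟩
    c * det (suc n) A + det (suc n) M
      ≡⟨ cong (λ d → c * d + det (suc n) M) (det-equalRows₀ n A p (λ _ → refl)) ⟩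
    c * + 0 + det (suc n) M
      ≡⟨ simplify c (det (suc n) M) ⟩
    det (suc n) M
      ∎
    where
    A : Matrix (suc n)
    A zero    = M (suc p)
    A (suc i) = M (suc i)
    simplify : ∀ x d → x * + 0 + d ≡ d
    simplify = solve-∀

  det-addCol₀Multiples : ∀ n (c : Fin n → ℤ) (M N : Matrix (suc n)) →
    (∀ i → N i zero ≡ M i zero) → (∀ i k → N i (suc k) ≡ M i (suc k) + c k * M i zero) →
    det (suc n) N ≡ det (suc n) M
  det-addCol₀Multiples n c M N col₀ cols = begin
    det (suc n) N                                   ≡⟨ det-transpose (suc n) N ⟨
    det (suc n) (transpose N)                       ≡⟨ det-cong (suc n) {transpose N} {addRow₀Multiples c (transpose M)}
                                                         (λ { zero i → col₀ i ; (suc k) i → cols i k }) ⟩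
    det (suc n) (addRow₀Multiples c (transpose M))  ≡⟨ det-addRow₀Multiples n c (transpose M) ⟩
    det (suc n) (transpose M)                       ≡⟨ det-transpose (suc n) M ⟩
    det (suc n) M                                   ∎

  det-singleEntryRow₀ : ∀ n (M : Matrix (suc n)) → (∀ j → M zero (suc j) ≡ + 0) →
    det (suc n) M ≡ M zero zero * det n (minor M zero)
  det-singleEntryRow₀ n M row₀ = begin
    det (suc n) M
      ≡⟨ det-expand n M ⟩
    laplaceTerm M zero + ∑[ j < n ] laplaceTerm M (suc j)
      ≡⟨ cong (_+_ (laplaceTerm M zero)) (sum-zero {n} (λ j → laplaceTerm-zeroEntry M (suc j) (row₀ j))) ⟩
    + 1 * (M zero zero * det n (minor M zero)) + + 0
      ≡⟨ trans (+-identityʳ _) (*-identityˡ _) ⟩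
    M zero zero * det n (minor M zero)
      ∎

  det-singleEntryCol₀ : ∀ n (M : Matrix (suc n)) → (∀ i → M (suc i) zero ≡ + 0) →
    det (suc n) M ≡ M zero zero * det n (minor M zero)
  det-singleEntryCol₀ n M col₀ = begin
    det (suc n) M                                   ≡⟨ det-transpose (suc n) M ⟨
    det (suc n) (transpose M)                       ≡⟨ det-singleEntryRow₀ n (transpose M) col₀ ⟩
    M zero zero * det n (minor (transpose M) zero)  ≡⟨ cong (M zero zero *_) (det-transpose n (minor M zero)) ⟩
    M zero zero * det n (minor M zero)              ∎

module ClassMatrix where
  open Determinant
  open import Data.Nat using (zero; suc)
  import Data.Nat.Properties as ℕ
  open import Data.Bool using (Bool; true; false; not; if_then_else_)
  open import Data.Bool.Properties using () renaming (_≟_ to _≟ᵇ_)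
  open import Data.Fin using (zero; suc)
  open import Data.Fin.Properties using (_≟_; any?)
  open import Data.Integer using (-_; _+_; _*_; _-_; _^_)
  open import Data.Integer.Properties
    using (+-identityˡ; +-identityʳ; *-identityˡ; *-identityʳ; *-zeroʳ; *-assoc; *-distribˡ-+; +-comm; pos-*; +-injective)
  open import Data.Integer.Tactic.RingSolver using (solve-∀)
  open import Data.Product using (∃; _,_)
  open import Function using (_∘_; _on_)
  open import Function.Definitions using (Injective)
  open import Relation.Nullary using (does; yes; no; contradiction)
  open import Relation.Nullary.Decidable using (dec-true; dec-false)
  open import Relation.Binary.PropositionalEquality
  open ≡-Reasoning

  𝟙 : Bool → ℤ
  𝟙 true  = + 1
  𝟙 false = + 0

  δ : ∀ {n} → Fin n → Fin n → ℤ → ℤ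
  δ i j x = if does (i ≟ j) then x else + 0

  δ-diag : ∀ {n} (i : Fin n) x → δ i i x ≡ x
  δ-diag i x rewrite dec-true (i ≟ i) refl = refl

  δ-offDiag : ∀ {n} {i j : Fin n} x → i ≢ j → δ i j x ≡ + 0
  δ-offDiag {i = i} {j} x i≢j rewrite dec-false (i ≟ j) i≢j = refl

  δ-comm : ∀ {n} (i j : Fin n) x → δ i j x ≡ δ j i x
  δ-comm i j x with i ≟ j
  ... | yes refl = sym (δ-diag i x)
  ... | no i≢j   = sym (δ-offDiag x (i≢j ∘ sym))

  sum-δ : ∀ {n} (f : Fin n → ℤ) p x → ∑[ c < n ] (f c * δ c p x) ≡ f p * x
  sum-δ f p x = begin
    ∑[ c < _ ] (f c * δ c p x)
      ≡⟨ sum-single (λ c → f c * δ c p x) p (λ c c≢p → trans (cong (f c *_) (δ-offDiag x c≢p)) (*-zeroʳ (f c))) ⟩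
    f p * δ p p x
      ≡⟨ cong (f p *_) (δ-diag p x) ⟩
    f p * x
      ∎

  sum-ones : ∀ n → ∑[ i < n ] (+ 1) ≡ + n
  sum-ones zero    = refl
  sum-ones (suc n) = cong (_+_ (+ 1)) (sum-ones n)

  -- Both sides equal ∑ᵢ ∑ₖ [φ k = i], summed in the two orders.
  count-bijection : ∀ {m c} (P : Fin m → Bool) (φ : Fin c → Fin m) → (∀ k → P (φ k) ≡ true) →
    Injective _≡_ _≡_ φ → (∀ i → P i ≡ true → ∃ λ k → φ k ≡ i) → ∑[ i < m ] 𝟙 (P i) ≡ + c
  count-bijection {m} {c} P φ P∘φ φ-injective φ-onto = begin
    ∑[ i < m ] 𝟙 (P i)                        ≡⟨ sum-cong-≗ fibre ⟩
    ∑[ i < m ] ∑[ k < c ] δ (φ k) i (+ 1)     ≡⟨ ∑-comm (λ i k → δ (φ k) i (+ 1)) ⟩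
    ∑[ k < c ] ∑[ i < m ] δ (φ k) i (+ 1)     ≡⟨ sum-cong-≗ (λ k → trans (sum-single _ (φ k) (λ i i≢φk → δ-offDiag (+ 1) (i≢φk ∘ sym)))
                                                                        (δ-diag (φ k) (+ 1))) ⟩
    ∑[ k < c ] (+ 1)                          ≡⟨ sum-ones c ⟩
    + c                                       ∎
    where
    fibre : ∀ i → 𝟙 (P i) ≡ ∑[ k < c ] δ (φ k) i (+ 1)
    fibre i with P i in Pi
    ... | true  = let k₀ , φk₀≡i = φ-onto i Pi in sym (begin
      ∑[ k < c ] δ (φ k) i (+ 1) ≡⟨ sum-single _ k₀ (λ k k≢k₀ →
                                      δ-offDiag (+ 1) (k≢k₀ ∘ φ-injective ∘ (λ φk≡i → trans φk≡i (sym φk₀≡i)))) ⟩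
      δ (φ k₀) i (+ 1)           ≡⟨ cong (λ j → δ j i (+ 1)) φk₀≡i ⟩
      δ i i (+ 1)                ≡⟨ δ-diag i (+ 1) ⟩
      + 1                        ∎)
    ... | false = sym (sum-zero {c} (λ k → δ-offDiag (+ 1) (λ φk≡i →
                    true≢false (trans (sym (P∘φ k)) (trans (cong P φk≡i) Pi)))))
      where
      true≢false : true ≢ false
      true≢false ()

  charMatrix-entry : ∀ n t (A : Matrix n) i j → charMatrix t A i j ≡ δ i j t - A i j
  charMatrix-entry (suc n) t A zero    zero    = refl
  charMatrix-entry (suc n) t A zero    (suc k) = sym (+-identityˡ _)
  charMatrix-entry (suc n) t A (suc i) zero    = sym (+-identityˡ _)
  charMatrix-entry (suc n) t A (suc i) (suc k) = charMatrix-entry n t (λ i′ k′ → A (suc i′) (suc k′)) i k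

  record IsBoolEquivalence {n} (S : Fin n → Fin n → Bool) : Set where
    field
      reflexive  : ∀ i → S i i ≡ true
      symmetric  : ∀ i j → S i j ≡ S j i
      transitive : ∀ i j k → S i j ≡ true → S j k ≡ S i k

    columns-agree : ∀ {i j} → S i j ≡ true → ∀ k → S k i ≡ S k j
    columns-agree {i} {j} i~j k = begin
      S k i ≡⟨ symmetric k i ⟩
      S i k ≡⟨ transitive i j k i~j ⟨
      S j k ≡⟨ symmetric j k ⟩
      S k j ∎

  restrict : ∀ {n} {S : Fin (suc n) → Fin (suc n) → Bool} → IsBoolEquivalence S → IsBoolEquivalence (S on suc)
  restrict equiv = record
    { reflexive  = λ i → reflexive (suc i)
    ; symmetric  = λ i j → symmetric (suc i) (suc j)
    ; transitive = λ i j k → transitive (suc i) (suc j) (suc k)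
    }
    where open IsBoolEquivalence equiv

  -- tI + (S + βJ) diag w; for β = -1 and w = 1 it is tI - A with A the complement of S.
  classMatrix : ∀ {n} → ℤ → ℤ → (Fin n → Fin n → Bool) → (Fin n → ℤ) → Matrix n
  classMatrix β t S w i j = δ i j t + w j * (𝟙 (S i j) + β)

  mergeWeight : ∀ {n} → Fin n → (Fin (suc n) → ℤ) → Fin n → ℤ
  mergeWeight p w c = w (suc c) + δ c p (w zero)

  sum-mergeWeight : ∀ {n} (p : Fin n) w → sum (mergeWeight p w) ≡ sum w
  sum-mergeWeight p w = begin
    ∑[ c < _ ] (w (suc c) + δ c p (w zero))
      ≡⟨ ∑-distrib-+ (w ∘ suc) (λ c → δ c p (w zero)) ⟩
    sum (w ∘ suc) + ∑[ c < _ ] δ c p (w zero)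
      ≡⟨ cong (_+_ (sum (w ∘ suc))) (sum-cong-≗ {x = λ c → δ c p (w zero)} (λ c → sym (*-identityˡ _))) ⟩
    sum (w ∘ suc) + ∑[ c < _ ] (+ 1 * δ c p (w zero))
      ≡⟨ cong (_+_ (sum (w ∘ suc))) (trans (sum-δ (λ _ → + 1) p (w zero)) (*-identityˡ (w zero))) ⟩
    sum (w ∘ suc) + w zero
      ≡⟨ +-comm (sum (w ∘ suc)) (w zero) ⟩
    sum w
      ∎

  module _ {n} {S : Fin (suc n) → Fin (suc n) → Bool} (equiv : IsBoolEquivalence S) (w : Fin (suc n) → ℤ) where
    open IsBoolEquivalence equiv

    -- Subtracting row p+1 from row 0 and then adding column 0 to column p+1 leaves t e₀ as row 0;
    -- the weight of column 0 moves into column p+1.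
    det-classMatrix-merge : ∀ p → S zero (suc p) ≡ true → ∀ β t →
      det (suc n) (classMatrix β t S w) ≡ t * det n (classMatrix β t (S on suc) (mergeWeight p w))
    det-classMatrix-merge p 0~p β t = begin
      det (suc n) N   ≡⟨ det-addRowToRow₀ n N N₁ p (- + 1) (λ _ _ → refl) row₀ ⟨
      det (suc n) N₁  ≡⟨ det-addCol₀Multiples n (λ k → δ k p (+ 1)) N₁ N₂ col₀ cols ⟨
      det (suc n) N₂  ≡⟨ det-singleEntryRow₀ n N₂ (λ _ → refl) ⟩
      t * det n (classMatrix β t (S on suc) (mergeWeight p w)) ∎
      where
      N = classMatrix β t S w
      N₁ N₂ : Matrix (suc n)
      N₁ zero    j = δ zero j t - δ j (suc p) t
      N₁ (suc i) j = N (suc i) j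
      N₂ zero    j = δ zero j t
      N₂ (suc i) j = classMatrix β t S (λ j → w j + δ j (suc p) (w zero)) (suc i) j

      row₀ : ∀ j → N₁ zero j ≡ N zero j + - + 1 * N (suc p) j
      row₀ j = begin
        δ zero j t - δ j (suc p) t
          ≡⟨ cong (_-_ (δ zero j t)) (δ-comm j (suc p) t) ⟩
        δ zero j t - δ (suc p) j t
          ≡⟨ cancel (δ zero j t) (δ (suc p) j t) (w j * (𝟙 (S (suc p) j) + β)) ⟩
        (δ zero j t + w j * (𝟙 (S (suc p) j) + β)) + - + 1 * (δ (suc p) j t + w j * (𝟙 (S (suc p) j) + β))
          ≡⟨ cong (λ s → (δ zero j t + w j * (𝟙 s + β)) + - + 1 * N (suc p) j) (transitive zero (suc p) j 0~p) ⟩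
        N zero j + - + 1 * N (suc p) j
          ∎
        where
        cancel : ∀ a b x → a - b ≡ (a + x) + - + 1 * (b + x)
        cancel = solve-∀

      col₀ : ∀ i → N₂ i zero ≡ N₁ i zero
      col₀ zero    = sym (+-identityʳ t)
      col₀ (suc i) = cong (λ v → δ (suc i) zero t + v * (𝟙 (S (suc i) zero) + β)) (+-identityʳ (w zero))

      cols : ∀ i k → N₂ i (suc k) ≡ N₁ i (suc k) + δ k p (+ 1) * N₁ i zero
      cols zero k with k ≟ p
      ... | yes _ = cancel t
        where
        cancel : ∀ t → + 0 ≡ (+ 0 - t) + + 1 * (t - + 0)
        cancel = solve-∀
      ... | no _ = refl
      cols (suc i) k with k ≟ p
      ... | yes refl = begin
        δ (suc i) (suc k) t + (w (suc k) + w zero) * (𝟙 (S (suc i) (suc k)) + β)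
          ≡⟨ distrib (δ (suc i) (suc k) t) (w (suc k)) (w zero) (𝟙 (S (suc i) (suc k)) + β) ⟩
        N (suc i) (suc k) + + 1 * (+ 0 + w zero * (𝟙 (S (suc i) (suc k)) + β))
          ≡⟨ cong (λ s → N (suc i) (suc k) + + 1 * (+ 0 + w zero * (𝟙 s + β))) (columns-agree 0~p (suc i)) ⟨
        N (suc i) (suc k) + + 1 * (+ 0 + w zero * (𝟙 (S (suc i) zero) + β))
          ∎
        where
        distrib : ∀ d a b x → d + (a + b) * x ≡ (d + a * x) + + 1 * (+ 0 + b * x)
        distrib = solve-∀
      ... | no _ = noop (δ (suc i) (suc k) t) (w (suc k)) (𝟙 (S (suc i) (suc k)) + β) (N₁ (suc i) zero)
        where
        noop : ∀ d a x y → d + (a + + 0) * x ≡ (d + a * x) + + 0 * y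
        noop = solve-∀

    -- With 0 in a class of its own, split row 0 as β w + (t + w₀) e₀; in the β-part,
    -- subtracting β times row 0 from the other rows leaves w₀ as the only entry of column 0.
    det-classMatrix-isolated : (∀ p → S zero (suc p) ≡ false) → ∀ β t →
      det (suc n) (classMatrix β t S w) ≡
        β * (w zero * det n (classMatrix (+ 0) t (S on suc) (w ∘ suc)))
          + (t + w zero) * det n (classMatrix β t (S on suc) (w ∘ suc))
    det-classMatrix-isolated isolated β t = begin
      det (suc n) N
        ≡⟨ det-linearRow (suc n) A B N zero β
             (λ { zero 0≢0 → contradiction refl 0≢0 ; (suc i) _ _ → refl })
             (λ { zero 0≢0 → contradiction refl 0≢0 ; (suc i) _ _ → refl })
             row₀ ⟩
      β * det (suc n) A + det (suc n) B
        ≡⟨ cong₂ (λ a b → β * a + b) detA (det-singleEntryRow₀ n B (λ _ → refl)) ⟩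
      β * (w zero * det n (classMatrix (+ 0) t (S on suc) (w ∘ suc)))
        + (t + w zero) * det n (classMatrix β t (S on suc) (w ∘ suc))
        ∎
      where
      N = classMatrix β t S w
      A B : Matrix (suc n)
      A zero    j = w j
      A (suc i) j = N (suc i) j
      B zero    j = δ zero j (t + w zero)
      B (suc i) j = N (suc i) j

      row₀ : ∀ j → N zero j ≡ β * A zero j + B zero j
      row₀ zero    rewrite reflexive zero = split t β (w zero)
        where
        split : ∀ t β w → t + w * (+ 1 + β) ≡ β * w + (t + w)
        split = solve-∀
      row₀ (suc j) rewrite isolated j = split β (w (suc j))
        where
        split : ∀ β w → + 0 + w * (+ 0 + β) ≡ β * w + + 0
        split = solve-∀

      A⁻ = addRow₀Multiples (λ _ → - β) A

      col₀ : ∀ i → A⁻ (suc i) zero ≡ + 0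
      col₀ i rewrite symmetric (suc i) zero | isolated i = cancel β (w zero)
        where
        cancel : ∀ β w → (+ 0 + w * (+ 0 + β)) + - β * w ≡ + 0
        cancel = solve-∀

      detA : det (suc n) A ≡ w zero * det n (classMatrix (+ 0) t (S on suc) (w ∘ suc))
      detA = begin
        det (suc n) A                      ≡⟨ det-addRow₀Multiples n (λ _ → - β) A ⟨
        det (suc n) A⁻                     ≡⟨ det-singleEntryCol₀ n A⁻ col₀ ⟩
        w zero * det n (minor A⁻ zero)     ≡⟨ cong (w zero *_) (det-cong n {minor A⁻ zero} (λ i k →
                                                drop-β (δ i k t) (w (suc k)) (𝟙 (S (suc i) (suc k))) β)) ⟩
        w zero * det n (classMatrix (+ 0) t (S on suc) (w ∘ suc)) ∎
        where
        drop-β : ∀ d w x b → (d + w * (x + b)) + - b * w ≡ d + w * (x + + 0)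
        drop-β = solve-∀

  module _ (b : ℕ) where

    HasClassWeight : ∀ {n} → (Fin n → Fin n → Bool) → (Fin n → ℤ) → Set
    HasClassWeight {n} S w = ∀ i → ∑[ j < n ] (𝟙 (S i j) * w j) ≡ + b

    classPoly : ℤ → ℤ → ℕ → ℤ
    classPoly β t zero    = + 1
    classPoly β t (suc q) = (t + + b) ^ q * (t + + b + β * (+ suc q * + b))

    classPoly-step : ∀ β t k q →
      β * (+ b * (t ^ k * classPoly (+ 0) t q)) + (t + + b) * (t ^ k * classPoly β t q) ≡ t ^ k * classPoly β t (suc q)
    classPoly-step β t k zero    = step β (+ b) (t ^ k) t
      where
      step : ∀ β B T t → β * (B * (T * + 1)) + (t + B) * (T * + 1) ≡ T * (+ 1 * (t + B + β * ((+ 1 + + 0) * B)))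
      step = solve-∀
    classPoly-step β t k (suc q) = step β (+ b) (t ^ k) t ((t + + b) ^ q) (+ suc q)
      where
      step : ∀ β B T t P Q → β * (B * (T * (P * (t + B + + 0 * (Q * B))))) + (t + B) * (T * (P * (t + B + β * (Q * B))))
                              ≡ T * ((t + B) * P * (t + B + β * ((+ 1 + Q) * B)))
      step = solve-∀

    -- q is the number of classes of S and k = n - q.
    record ClassDeterminant {n} (S : Fin n → Fin n → Bool) (w : Fin n → ℤ) : Set where
      field
        k q             : ℕ
        n≡k+q           : n ≡ k ℕ.+ q
        totalWeight     : sum w ≡ + q * + b
        det-classMatrix : ∀ β t → det n (classMatrix β t S w) ≡ t ^ k * classPoly β t q

    module _ {n} {S : Fin (suc n) → Fin (suc n) → Bool} (equiv : IsBoolEquivalence S) {w : Fin (suc n) → ℤ}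
             (weight : HasClassWeight S w) where
      open IsBoolEquivalence equiv

      classWeight-merge : ∀ p → S zero (suc p) ≡ true → HasClassWeight (S on suc) (mergeWeight p w)
      classWeight-merge p 0~p i = begin
        ∑[ c < n ] (𝟙 (S (suc i) (suc c)) * (w (suc c) + δ c p (w zero)))
          ≡⟨ sum-cong-≗ (λ c → *-distribˡ-+ (𝟙 (S (suc i) (suc c))) (w (suc c)) _) ⟩
        ∑[ c < n ] (𝟙 (S (suc i) (suc c)) * w (suc c) + 𝟙 (S (suc i) (suc c)) * δ c p (w zero))
          ≡⟨ ∑-distrib-+ (λ c → 𝟙 (S (suc i) (suc c)) * w (suc c))
                         (λ c → 𝟙 (S (suc i) (suc c)) * δ c p (w zero)) ⟩
        rest + ∑[ c < n ] (𝟙 (S (suc i) (suc c)) * δ c p (w zero))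
          ≡⟨ cong (_+_ rest) (sum-δ (λ c → 𝟙 (S (suc i) (suc c))) p (w zero)) ⟩
        rest + 𝟙 (S (suc i) (suc p)) * w zero
          ≡⟨ cong (λ s → rest + 𝟙 s * w zero) (columns-agree 0~p (suc i)) ⟨
        rest + 𝟙 (S (suc i) zero) * w zero
          ≡⟨ +-comm rest (𝟙 (S (suc i) zero) * w zero) ⟩
        ∑[ j < suc n ] (𝟙 (S (suc i) j) * w j)
          ≡⟨ weight (suc i) ⟩
        + b ∎
        where
        rest = ∑[ c < n ] (𝟙 (S (suc i) (suc c)) * w (suc c))

      module _ (isolated : ∀ p → S zero (suc p) ≡ false) where

        classWeight-isolated : HasClassWeight (S on suc) (w ∘ suc)
        classWeight-isolated i = begin
          rest
            ≡⟨ +-identityˡ rest ⟨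
          + 0 + rest
            ≡⟨ cong (λ s → 𝟙 s * w zero + rest) (trans (symmetric (suc i) zero) (isolated i)) ⟨
          ∑[ j < suc n ] (𝟙 (S (suc i) j) * w j)
            ≡⟨ weight (suc i) ⟩
          + b
            ∎
          where
          rest = ∑[ c < n ] (𝟙 (S (suc i) (suc c)) * w (suc c))

        weight-isolated : w zero ≡ + b
        weight-isolated = begin
          w zero                               ≡⟨ *-identityˡ (w zero) ⟨
          + 1 * w zero                         ≡⟨ +-identityʳ (+ 1 * w zero) ⟨
          + 1 * w zero + + 0                   ≡⟨ cong (_+_ (+ 1 * w zero)) rest≡0 ⟨
          + 1 * w zero + rest                  ≡⟨ cong (λ s → 𝟙 s * w zero + rest) (reflexive zero) ⟨
          ∑[ j < suc n ] (𝟙 (S zero j) * w j)  ≡⟨ weight zero ⟩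
          + b                                  ∎
          where
          rest = ∑[ c < n ] (𝟙 (S zero (suc c)) * w (suc c))
          rest≡0 : rest ≡ + 0
          rest≡0 = sum-zero {n} (λ c → cong (λ s → 𝟙 s * w (suc c)) (isolated c))

    classDeterminant : ∀ n (S : Fin n → Fin n → Bool) (w : Fin n → ℤ) →
      IsBoolEquivalence S → HasClassWeight S w → ClassDeterminant S w
    classDeterminant zero    S w _ _ = record
      { k = 0 ; q = 0 ; n≡k+q = refl ; totalWeight = refl ; det-classMatrix = λ _ _ → refl }
    classDeterminant (suc n) S w equiv weight with any? (λ p → S zero (suc p) ≟ᵇ true)
    ... | yes (p , 0~p) = record
      { k               = suc k
      ; q               = q
      ; n≡k+q           = cong suc n≡k+q
      ; totalWeight     = trans (sym (sum-mergeWeight p w)) totalWeight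
      ; det-classMatrix = λ β t → begin
          det (suc n) (classMatrix β t S w)                       ≡⟨ det-classMatrix-merge equiv w p 0~p β t ⟩
          t * det n (classMatrix β t (S on suc) (mergeWeight p w)) ≡⟨ cong (t *_) (det-classMatrix β t) ⟩
          t * (t ^ k * classPoly β t q)                            ≡⟨ *-assoc t (t ^ k) _ ⟨
          t ^ suc k * classPoly β t q                              ∎
      }
      where
      open ClassDeterminant
        (classDeterminant n (S on suc) (mergeWeight p w) (restrict equiv) (classWeight-merge equiv {w} weight p 0~p))
    ... | no has-no-mate = record
      { k               = k
      ; q               = suc q
      ; n≡k+q           = trans (cong suc n≡k+q) (sym (ℕ.+-suc k q))
      ; totalWeight     = trans (cong₂ _+_ w₀≡b totalWeight) (count (+ b) (+ q))
      ; det-classMatrix = λ β t → begin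
          det (suc n) (classMatrix β t S w)
            ≡⟨ det-classMatrix-isolated equiv w isolated β t ⟩
          β * (w zero * det n (classMatrix (+ 0) t (S on suc) (w ∘ suc)))
            + (t + w zero) * det n (classMatrix β t (S on suc) (w ∘ suc))
            ≡⟨ cong₂ (λ d d′ → β * (w zero * d) + (t + w zero) * d′) (det-classMatrix (+ 0) t) (det-classMatrix β t) ⟩
          β * (w zero * (t ^ k * classPoly (+ 0) t q)) + (t + w zero) * (t ^ k * classPoly β t q)
            ≡⟨ cong (λ x → β * (x * (t ^ k * classPoly (+ 0) t q)) + (t + x) * (t ^ k * classPoly β t q)) w₀≡b ⟩
          β * (+ b * (t ^ k * classPoly (+ 0) t q)) + (t + + b) * (t ^ k * classPoly β t q)
            ≡⟨ classPoly-step β t k q ⟩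
          t ^ k * classPoly β t (suc q)
            ∎
      }
      where
      isolated : ∀ p → S zero (suc p) ≡ false
      isolated p with S zero (suc p) in eq
      ... | true  = contradiction (p , eq) has-no-mate
      ... | false = refl
      w₀≡b = weight-isolated equiv {w} weight isolated
      open ClassDeterminant
        (classDeterminant n (S on suc) (w ∘ suc) (restrict equiv) (classWeight-isolated equiv {w} weight isolated))
      count : ∀ B Q → B + Q * B ≡ (+ 1 + Q) * B
      count = solve-∀

  classPoly-minusOne : ∀ {m k q b} t → m ≡ k ℕ.+ q → m ≡ q ℕ.* b → Fin m →
    t ^ k * classPoly b (- + 1) t q ≡ (t - + (m ∸ b)) * ((t + + b) ^ (q ∸ 1) * t ^ (q ℕ.* (b ∸ 1)))
  classPoly-minusOne {q = zero}              t _ refl ()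
  classPoly-minusOne {q = suc q} {b = zero}  t _ m≡q*0 i with () ← subst Fin (trans m≡q*0 (ℕ.*-zeroʳ q)) i
  classPoly-minusOne {m} {k} {suc q} {suc b} t m≡k+q m≡q*b _ = begin
    t ^ k * ((t + + suc b) ^ q * (t + + suc b + - + 1 * (+ suc q * + suc b)))
      ≡⟨ collect t (+ suc b) (+ q) ((t + + suc b) ^ q) (t ^ k) ⟩
    (t - + q * + suc b) * ((t + + suc b) ^ q * t ^ k)
      ≡⟨ cong₂ (λ a e → (t - a) * ((t + + suc b) ^ q * t ^ e))
               (trans (sym (pos-* q (suc b))) (cong +_ a≡q*b)) k≡q*b ⟩
    (t - + (m ∸ suc b)) * ((t + + suc b) ^ q * t ^ (suc q ℕ.* b))
      ∎
    where
    collect : ∀ t B Q P T → T * (P * (t + B + - + 1 * ((+ 1 + Q) * B))) ≡ (t - Q * B) * (P * T)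
    collect = solve-∀
    a≡q*b : q ℕ.* suc b ≡ m ∸ suc b
    a≡q*b = sym (trans (cong (_∸ suc b) m≡q*b) (ℕ.m+n∸m≡n (suc b) (q ℕ.* suc b)))
    k≡q*b : k ≡ suc q ℕ.* b
    k≡q*b = ℕ.+-cancelʳ-≡ (suc q) k (suc q ℕ.* b)
      (trans (sym m≡k+q) (trans m≡q*b (trans (ℕ.*-suc (suc q) b) (ℕ.+-comm (suc q) (suc q ℕ.* b)))))

  charPoly-completeMultipartite : ∀ {m b} (A : Matrix m) (S : Fin m → Fin m → Bool) → IsBoolEquivalence S →
    (∀ i → ∑[ j < m ] 𝟙 (S i j) ≡ + b) → (∀ i j → A i j ≡ 𝟙 (not (S i j))) → Fin m →
    Σ ℕ λ q → m ≡ q ℕ.* b ×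
      (∀ t → charPoly m A t ≡ (t - + (m ∸ b)) * ((t + + b) ^ (q ∸ 1) * t ^ (q ℕ.* (b ∸ 1))))
  charPoly-completeMultipartite {m} {b} A S equiv classSize A≡ i₀ = q , m≡q*b , λ t → begin
    charPoly m A t
      ≡⟨ det-cong m (λ i j → trans (charMatrix-entry m t A i j) (entry (δ i j t) (S i j) (A≡ i j))) ⟩
    det m (classMatrix (- + 1) t S (λ _ → + 1))
      ≡⟨ det-classMatrix (- + 1) t ⟩
    t ^ k * classPoly b (- + 1) t q
      ≡⟨ classPoly-minusOne {m} {k} {q} {b} t n≡k+q m≡q*b i₀ ⟩
    (t - + (m ∸ b)) * ((t + + b) ^ (q ∸ 1) * t ^ (q ℕ.* (b ∸ 1)))
      ∎
    where
    open ClassDeterminant (classDeterminant b m S (λ _ → + 1) equiv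
      (λ i → trans (sum-cong-≗ (λ j → *-identityʳ (𝟙 (S i j)))) (classSize i)))
    m≡q*b : m ≡ q ℕ.* b
    m≡q*b = +-injective (begin
      + m             ≡⟨ sum-ones m ⟨
      ∑[ i < m ] (+ 1) ≡⟨ totalWeight ⟩
      + q * + b       ≡⟨ pos-* q b ⟨
      + (q ℕ.* b)     ∎)
    entry : ∀ d s {a} → a ≡ 𝟙 (not s) → d - a ≡ d + + 1 * (𝟙 s + - + 1)
    entry d true  refl = nonadjacent d
      where
      nonadjacent : ∀ d → d - + 0 ≡ d + + 1 * (+ 1 + - + 1)
      nonadjacent = solve-∀
    entry d false refl = adjacent d
      where
      adjacent : ∀ d → d - + 1 ≡ d + + 1 * (+ 0 + - + 1)
      adjacent = solve-∀

module CommutativeRingLemmas (R : CommutativeRing 0ℓ 0ℓ) where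
  open CommutativeRing R
  open import Relation.Binary.Reasoning.Setoid setoid
  open import Algebra.Properties.Ring ring public
    using ( x[y-z]≈xy-xz; -‿distribʳ-*; -‿distribˡ-*; ⁻¹-anti-homo‿-; -‿involutive; -‿+-comm; -0#≈0#
          ; //-rightDividesˡ)
  open import Algebra.Properties.CommutativeSemigroup *-commutativeSemigroup public
    using (x∙yz≈y∙xz)
  open import Algebra.Properties.CommutativeSemigroup +-commutativeSemigroup
    using () renaming (interchange to +-interchange)
  open import Data.Product using (_,_)

  x-0≈x : ∀ a → a - 0# ≈ a
  x-0≈x a = trans (+-congˡ -0#≈0#) (+-identityʳ a)

  [x-y]+y≈x : ∀ a b → (a - b) + b ≈ a
  [x-y]+y≈x a b = //-rightDividesˡ b a

  x-[x-y]≈y : ∀ a b → a - (a - b) ≈ b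
  x-[x-y]≈y a b = begin
    a - (a - b) ≈⟨ +-congˡ (⁻¹-anti-homo‿- a b) ⟩
    a + (b - a) ≈⟨ +-comm a (b - a) ⟩
    (b - a) + a ≈⟨ [x-y]+y≈x b a ⟩
    b           ∎

  [x-y]+[y-z]≈x-z : ∀ a b c → (a - b) + (b - c) ≈ a - c
  [x-y]+[y-z]≈x-z a b c = begin
    (a - b) + (b - c)   ≈⟨ +-assoc (a - b) b (- c) ⟨
    ((a - b) + b) - c   ≈⟨ +-congʳ ([x-y]+y≈x a b) ⟩
    a - c               ∎

  [x-y]+[z-w]≈[x+z]-[y+w] : ∀ a b c d → (a - b) + (c - d) ≈ (a + c) - (b + d)
  [x-y]+[z-w]≈[x+z]-[y+w] a b c d = trans (+-interchange a (- b) c (- d)) (+-congˡ (-‿+-comm b d))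

  -x*-y≈x*y : ∀ a b → (- a) * (- b) ≈ a * b
  -x*-y≈x*y a b = begin
    (- a) * (- b)  ≈⟨ -‿distribˡ-* a (- b) ⟨
    - (a * - b)    ≈⟨ -‿cong (-‿distribʳ-* a b) ⟨
    - (- (a * b))  ≈⟨ -‿involutive (a * b) ⟩
    a * b          ∎

  unit-resp : ∀ {r s} → r ≈ s → IsUnit R r → IsUnit R s
  unit-resp r≈s (t , rt≈1) = t , trans (*-congʳ (sym r≈s)) rt≈1

  unit-neg : ∀ {u} → IsUnit R u → IsUnit R (- u)
  unit-neg {u} (t , ut≈1) = - t , trans (-x*-y≈x*y u t) ut≈1

  x*u≈0⇒x≈0 : ∀ {x u} → IsUnit R u → x * u ≈ 0# → x ≈ 0#
  x*u≈0⇒x≈0 {x} {u} (t , ut≈1) xu≈0 = begin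
    x              ≈⟨ *-identityʳ x ⟨
    x * 1#         ≈⟨ *-congˡ ut≈1 ⟨
    x * (u * t)    ≈⟨ *-assoc x u t ⟨
    (x * u) * t    ≈⟨ *-congʳ xu≈0 ⟩
    0# * t         ≈⟨ zeroˡ t ⟩
    0#             ∎

module FiniteRing (R : CommutativeRing 0ℓ 0ℓ) (finite : IsFiniteRing R) where
  open CommutativeRing R hiding (zero)
  open CommutativeRingLemmas R
  open import Data.Fin using (zero; suc)
  open import Function using (_∘_)
  open import Data.Fin.Properties as Fin using (any?)
  open import Data.Product using (∃; _,_; proj₁; proj₂)
  open import Relation.Nullary using (Dec; yes; no; contradiction)
  open import Relation.Nullary.Decidable using (map′)
  open import Relation.Unary using (Pred; _⊆_) renaming (Decidable to Decidableᵘ)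
  open import Relation.Binary using (Decidable; _Respects_)
  import Relation.Binary.PropositionalEquality as ≡

  private
    size = proj₁ finite
    enum = proj₁ (proj₂ finite)
    module E = Enumerates (proj₂ (proj₂ finite))

    index : Carrier → Fin size
    index y = proj₁ (E.surjective y _)

    enum-index : ∀ y → enum (index y) ≈ y
    enum-index y = proj₂ (E.surjective y _)

  infix 4 _≈?_
  _≈?_ : Decidable _≈_
  y ≈? z = map′
    (λ eq → trans (sym (enum-index y)) (trans (reflexive (≡.cong enum eq)) (enum-index z)))
    (λ y≈z → E.injective (index y) (index z) (trans (enum-index y) (trans y≈z (sym (enum-index z)))))
    (index y Fin.≟ index z)

  search : {P : Pred Carrier 0ℓ} → P Respects _≈_ → Decidableᵘ P → Dec (∃ P)
  search resp P? with any? (λ i → P? (enum i))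
  ... | yes (i , Pi) = yes (enum i , Pi)
  ... | no ¬P        = no λ (y , Py) → ¬P (index y , resp (sym (enum-index y)) Py)

  isUnit? : Decidableᵘ (IsUnit R)
  isUnit? r = search (λ s≈s′ rs≈1 → trans (*-congˡ (sym s≈s′)) rs≈1) (λ s → r * s ≈? 1#)

  record DecProperIdeal : Set₁ where
    field
      member  : Pred Carrier 0ℓ
      isIdeal : IsIdeal R member
      member? : Decidableᵘ member
      proper  : IsProper R member
    open IsIdeal isIdeal public
  open DecProperIdeal

  adjoin : Pred Carrier 0ℓ → Carrier → Pred Carrier 0ℓ
  adjoin I z y = ∃ λ s → I (y - z * s)

  module _ (I : DecProperIdeal) (z : Carrier) where
    private module I = DecProperIdeal I

    adjoin-isIdeal : IsIdeal R (adjoin I.member z)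
    adjoin-isIdeal = record
      { resp     = λ { y≈y′ (s , h) → s , I.resp (+-congʳ y≈y′) h }
      ; zero∈    = 0# , I.resp (sym (trans (+-congˡ (-‿cong (zeroʳ z))) (x-0≈x 0#))) I.zero∈
      ; +-closed = λ { {y} {y′} (s , h) (s′ , h′) → s + s′ ,
          I.resp (trans ([x-y]+[z-w]≈[x+z]-[y+w] y (z * s) y′ (z * s′)) (+-congˡ (-‿cong (sym (distribˡ z s s′)))))
                 (I.+-closed h h′) }
      ; *-closed = λ { r {y} (s , h) → r * s ,
          I.resp (trans (x[y-z]≈xy-xz r y (z * s)) (+-congˡ (-‿cong (x∙yz≈y∙xz r z s)))) (I.*-closed r h) }
      }

    adjoin? : Decidableᵘ (adjoin I.member z)
    adjoin? y = search (λ s≈s′ h → I.resp (+-congˡ (-‿cong (*-congˡ s≈s′))) h) (λ s → I.member? (y - z * s))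

    ⊆adjoin : I.member ⊆ adjoin I.member z
    ⊆adjoin {y} h = 0# , I.resp (sym (trans (+-congˡ (-‿cong (zeroʳ z))) (x-0≈x y))) h

    ∈adjoin : adjoin I.member z z
    ∈adjoin = 1# , I.resp (sym (trans (+-congˡ (-‿cong (*-identityʳ z))) (-‿inverseʳ z))) I.zero∈

  adjoin-mono : ∀ {I J : Pred Carrier 0ℓ} z → I ⊆ J → adjoin I z ⊆ adjoin J z
  adjoin-mono z I⊆J (s , h) = s , I⊆J h

  adjoinIfProper : (I : DecProperIdeal) (z : Carrier) →
    Σ DecProperIdeal λ J → member I ⊆ member J × (¬ adjoin (member I) z 1# → member J z)
  adjoinIfProper I z with adjoin? I z 1#
  ... | yes 1∈ = I , (λ h → h) , contradiction 1∈
  ... | no ¬1∈ = J , ⊆adjoin I z , λ _ → ∈adjoin I z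
    where
    J : DecProperIdeal
    J = record { member = adjoin (member I) z ; isIdeal = adjoin-isIdeal I z ; member? = adjoin? I z ; proper = ¬1∈ }

  saturate : ∀ {k} (f : Fin k → Carrier) (I : DecProperIdeal) →
    Σ DecProperIdeal λ J → member I ⊆ member J × (∀ i → ¬ adjoin (member J) (f i) 1# → member J (f i))
  saturate {ℕ.zero}  f I = I , (λ h → h) , λ ()
  saturate {ℕ.suc k} f I =
    J , I′⊆J ∘ I⊆I′ , λ
      { zero    ¬1∈ → I′⊆J (added (¬1∈ ∘ adjoin-mono {member I} {member J} (f zero) (I′⊆J ∘ I⊆I′)))
      ; (suc i)     → saturated i
      }
    where
    step = adjoinIfProper I (f zero)
    I′ = proj₁ step
    I⊆I′ = proj₁ (proj₂ step)
    added = proj₂ (proj₂ step)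
    rest = saturate (λ i → f (suc i)) I′
    J = proj₁ rest
    I′⊆J = proj₁ (proj₂ rest)
    saturated = proj₂ (proj₂ rest)

  principalIdeal : ∀ r → ¬ IsUnit R r → DecProperIdeal
  principalIdeal r r∉R* = record
    { member  = Ix R r
    ; isIdeal = record
      { resp     = λ { y≈y′ (s , y≈rs) → s , trans (sym y≈y′) y≈rs }
      ; zero∈    = 0# , sym (zeroʳ r)
      ; +-closed = λ { (s , y≈rs) (s′ , y′≈rs′) →
          s + s′ , trans (+-cong y≈rs y′≈rs′) (sym (distribˡ r s s′)) }
      ; *-closed = λ { t (s , y≈rs) → t * s , trans (*-congˡ y≈rs) (x∙yz≈y∙xz t r s) }
      }
    ; member? = λ y → search (λ s≈s′ y≈rs → trans y≈rs (*-congˡ s≈s′)) (λ s → y ≈? r * s)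
    ; proper  = λ (s , 1≈rs) → r∉R* (s , sym 1≈rs)
    }

  -- Saturating r R over an enumeration of the ring yields a maximal ideal: any proper ideal
  -- above it contains each of its elements y, so adjoining y kept the ideal proper.
  nonunit-inMaximalIdeal : ∀ r → ¬ IsUnit R r → Σ (Pred Carrier 0ℓ) λ M → IsMaximalIdeal R M × M r
  nonunit-inMaximalIdeal r r∉R* = member J , (isIdeal J , proper J , maximal) , rR⊆J (1# , sym (*-identityʳ r))
    where
    saturated = saturate enum (principalIdeal r r∉R*)
    J = proj₁ saturated
    rR⊆J = proj₁ (proj₂ saturated)
    maximal : ∀ K → IsIdeal R K → IsProper R K → member J ⊆ K → K ⊆ member J
    maximal K K-ideal K-proper J⊆K {y} y∈K = resp J (enum-index y) (proj₂ (proj₂ saturated) (index y) 1∉)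
      where
      module K = IsIdeal K-ideal
      z = enum (index y)
      1∉ : ¬ adjoin (member J) z 1#
      1∉ (s , 1-zs∈J) = K-proper (K.resp ([x-y]+y≈x 1# (z * s))
        (K.+-closed (J⊆K 1-zs∈J) (K.resp (*-comm s z) (K.*-closed s (K.resp (sym (enum-index y)) y∈K)))))

module FiniteLocalRing (R : CommutativeRing 0ℓ 0ℓ) (finite : IsFiniteRing R) (local : IsLocalRing R) where
  open CommutativeRing R
  open CommutativeRingLemmas R
  open FiniteRing R finite using (isUnit?; nonunit-inMaximalIdeal)
  open import Data.Product using (_,_; proj₁; proj₂)
  open import Function using (_∘_)
  open import Relation.Nullary using (yes; no; contradiction)

  private
    M = proj₁ local
    M-maximal = proj₁ (proj₂ local)
    module M = IsIdeal (proj₁ M-maximal)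

  nonunit⇒∈maximal : ∀ {r} → ¬ IsUnit R r → M r
  nonunit⇒∈maximal {r} r∉R* =
    let N , N-maximal , r∈N = nonunit-inMaximalIdeal r r∉R* in proj₁ (proj₂ (proj₂ local) N N-maximal) r∈N

  ∈maximal⇒nonunit : ∀ {r} → M r → ¬ IsUnit R r
  ∈maximal⇒nonunit {r} r∈M (s , rs≈1) =
    proj₁ (proj₂ M-maximal) (M.resp (trans (*-comm s r) rs≈1) (M.*-closed s r∈M))

  nonunit-+ : ∀ {r s} → ¬ IsUnit R r → ¬ IsUnit R s → ¬ IsUnit R (r + s)
  nonunit-+ r∉R* s∉R* = ∈maximal⇒nonunit (M.+-closed (nonunit⇒∈maximal r∉R*) (nonunit⇒∈maximal s∉R*))

  nonunit-neg : ∀ {r} → ¬ IsUnit R r → ¬ IsUnit R (- r)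
  nonunit-neg {r} r∉R* = r∉R* ∘ unit-resp (-‿involutive r) ∘ unit-neg

  -- If r were a nonunit, u ≈ r - (r - u) would be a sum of two nonunits:
  -- r - u is one because x (r - u) ≈ 0 with x ≉ 0.
  unit-cancelˡ : ∀ {x r u} → ¬ x ≈ 0# → x * r ≈ x * u → IsUnit R u → IsUnit R r
  unit-cancelˡ {x} {r} {u} x≉0 xr≈xu u∈R* with isUnit? r
  ... | yes r∈R* = r∈R*
  ... | no  r∉R* = contradiction (unit-resp (sym (x-[x-y]≈y r u)) u∈R*) (nonunit-+ r∉R* (nonunit-neg r-u∉R*))
    where
    r-u∉R* : ¬ IsUnit R (r - u)
    r-u∉R* r-u∈R* =
      x≉0 (x*u≈0⇒x≈0 r-u∈R* (trans (x[y-z]≈xy-xz x r u) (trans (+-congʳ xr≈xu) (-‿inverseʳ (x * u)))))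

module NonunitMultiples (R : CommutativeRing 0ℓ 0ℓ) (finite : IsFiniteRing R) (local : IsLocalRing R)
  {x : CommutativeRing.Carrier R} (x≉0 : ¬ CommutativeRing._≈_ R x (CommutativeRing.0# R)) where
  open CommutativeRing R
  open CommutativeRingLemmas R
  open FiniteLocalRing R finite local
  open import Relation.Binary.Reasoning.Setoid setoid
  open import Data.Product using (_,_)
  open import Function using (_∘_)

  Ix-sub : ∀ {p q} → Ix R x p → Ix R x q → Ix R x (p - q)
  Ix-sub (r , p≈xr) (s , q≈xs) = r - s , trans (+-cong p≈xr (-‿cong q≈xs)) (sym (x[y-z]≈xy-xz x r s))

  xR*-resp : ∀ {p q} → p ≈ q → xR* R x p → xR* R x q
  xR*-resp p≈q (u , u∈R* , p≈xu) = u , u∈R* , trans (sym p≈q) p≈xu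

  Mx-resp : ∀ {p q} → p ≈ q → Mx R x p → Mx R x q
  Mx-resp p≈q ((r , p≈xr) , p∉xR*) = (r , trans (sym p≈q) p≈xr) , p∉xR* ∘ xR*-resp (sym p≈q)

  Mx-0 : Mx R x 0#
  Mx-0 = (0# , sym (zeroʳ x)) , λ (u , u∈R* , 0≈xu) → x≉0 (x*u≈0⇒x≈0 u∈R* (sym 0≈xu))

  Mx-neg : ∀ {p} → Mx R x p → Mx R x (- p)
  Mx-neg {p} ((r , p≈xr) , p∉xR*) = (- r , trans (-‿cong p≈xr) (-‿distribʳ-* x r)) , λ (u , u∈R* , -p≈xu) →
    p∉xR* (- u , unit-neg u∈R* , (begin
      p          ≈⟨ -‿involutive p ⟨
      - (- p)    ≈⟨ -‿cong -p≈xu ⟩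
      - (x * u)  ≈⟨ -‿distribʳ-* x u ⟩
      x * - u    ∎))

  Mx-+ : ∀ {p q} → Mx R x p → Mx R x q → Mx R x (p + q)
  Mx-+ {p} {q} ((r , p≈xr) , p∉xR*) ((s , q≈xs) , q∉xR*) = (r + s , p+q≈x[r+s]) , λ (u , u∈R* , p+q≈xu) →
    nonunit-+ (λ r∈R* → p∉xR* (r , r∈R* , p≈xr)) (λ s∈R* → q∉xR* (s , s∈R* , q≈xs))
      (unit-cancelˡ x≉0 (trans (sym p+q≈x[r+s]) p+q≈xu) u∈R*)
    where
    p+q≈x[r+s] = trans (+-cong p≈xr q≈xs) (sym (distribˡ x r s))

module CayleyGraph (R : CommutativeRing 0ℓ 0ℓ) (finite : IsFiniteRing R) (local : IsLocalRing R)
  (x : CommutativeRing.Carrier R) (x≉0 : ¬ CommutativeRing._≈_ R x (CommutativeRing.0# R))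
  {m} (e : Fin m → CommutativeRing.Carrier R) (e-enum : Enumerates R (Ix R x) e)
  {a} (f : Fin a → CommutativeRing.Carrier R) (f-enum : Enumerates R (xR* R x) f)
  {b} (g : Fin b → CommutativeRing.Carrier R) (g-enum : Enumerates R (Mx R x) g)
  (A : Matrix m) (A-adj : IsAdjacencyMatrix (λ i j → CayAdj R x (e i) (e j)) A) where
  open CommutativeRing R hiding (refl; sym; trans; reflexive)
  open CommutativeRingLemmas R
  open NonunitMultiples R finite local x≉0
  open ClassMatrix
  open Determinant using (sum-syntax; sum-cong-≗; ∑-distrib-+)
  open import Data.Bool using (Bool; true; false; not)
  open import Data.Integer.Properties using (+-injective; pos-+)
  open import Data.Nat.Properties using (m+n∸n≡m)
  open import Data.Product using (∃; _,_; proj₁; proj₂)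
  open import Data.Sum using (inj₁; inj₂)
  open import Function using (_∘_)
  open import Function.Definitions using (Injective)
  open import Relation.Nullary using (does; contradiction)
  open import Relation.Unary using (Pred; _⊆_)
  open import Relation.Binary.PropositionalEquality as ≡ using (refl; sym; trans; cong; cong₂)
  module ≈ = CommutativeRing R using (refl; sym; trans; reflexive)
  private
    module E = Enumerates e-enum

  -- S i j records non-adjacency, i.e. e i - e j ∈ M_x.
  S : Fin m → Fin m → Bool
  S i j = does (A i j ℤ.≟ + 0)

  A≡𝟙[not-S] : ∀ i j → A i j ≡ 𝟙 (not (S i j))
  A≡𝟙[not-S] i j with A-adj i j
  ... | inj₁ (A≡1 , _) rewrite A≡1 = refl
  ... | inj₂ (A≡0 , _) rewrite A≡0 = refl

  S⇒nonadjacent : ∀ {i j} → S i j ≡ true → ¬ CayAdj R x (e i) (e j)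
  S⇒nonadjacent {i} {j} Sij with A-adj i j
  ... | inj₁ (A≡1 , _) rewrite A≡1 = contradiction Sij λ ()
  ... | inj₂ (_ , ¬adj) = ¬adj

  nonadjacent⇒S : ∀ {i j} → ¬ CayAdj R x (e i) (e j) → S i j ≡ true
  nonadjacent⇒S {i} {j} ¬adj with A-adj i j
  ... | inj₁ (_ , adj) = contradiction adj ¬adj
  ... | inj₂ (A≡0 , _) rewrite A≡0 = refl

  not-S⇒adjacent : ∀ {i j} → not (S i j) ≡ true → CayAdj R x (e i) (e j)
  not-S⇒adjacent {i} {j} ¬Sij with A-adj i j
  ... | inj₁ (_ , adj) = adj
  ... | inj₂ (A≡0 , _) rewrite A≡0 = contradiction ¬Sij λ ()

  adjacent⇒not-S : ∀ {i j} → CayAdj R x (e i) (e j) → not (S i j) ≡ true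
  adjacent⇒not-S {i} {j} adj with A-adj i j
  ... | inj₁ (A≡1 , _) rewrite A≡1 = refl
  ... | inj₂ (_ , ¬adj) = contradiction adj ¬adj

  S⇒Mx : ∀ {i j} → S i j ≡ true → Mx R x (e i - e j)
  S⇒Mx {i} {j} Sij = Ix-sub (E.inP i) (E.inP j) , S⇒nonadjacent Sij

  Mx⇒S : ∀ {i j} → Mx R x (e i - e j) → S i j ≡ true
  Mx⇒S = nonadjacent⇒S ∘ proj₂

  bool-ext : ∀ {p q : Bool} → (p ≡ true → q ≡ true) → (q ≡ true → p ≡ true) → p ≡ q
  bool-ext {true}  {q}     p⇒q _   = sym (p⇒q refl)
  bool-ext {false} {true}  _   q⇒p = q⇒p refl
  bool-ext {false} {false} _   _   = refl

  S-isBoolEquivalence : IsBoolEquivalence S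
  S-isBoolEquivalence = record
    { reflexive  = λ i → Mx⇒S (Mx-resp (≈.sym (-‿inverseʳ (e i))) Mx-0)
    ; symmetric  = λ i j → bool-ext (flip i j) (flip j i)
    ; transitive = λ i j k Sij → bool-ext
        (λ Sjk → Mx⇒S (Mx-resp ([x-y]+[y-z]≈x-z (e i) (e j) (e k)) (Mx-+ (S⇒Mx Sij) (S⇒Mx Sjk))))
        (λ Sik → Mx⇒S (Mx-resp (≈.trans (+-congʳ (⁻¹-anti-homo‿- (e i) (e j))) ([x-y]+[y-z]≈x-z (e j) (e i) (e k)))
                                (Mx-+ (Mx-neg (S⇒Mx Sij)) (S⇒Mx Sik))))
    }
    where
    flip : ∀ i j → S i j ≡ true → S j i ≡ true
    flip i j Sij = Mx⇒S (Mx-resp (⁻¹-anti-homo‿- (e i) (e j)) (Mx-neg (S⇒Mx Sij)))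

  -- y ↦ e i - y is a bijection from any subset of I_x onto the corresponding part of row i.
  count-row : ∀ {c} {P : Pred Carrier 0ℓ} (h : Fin c → Carrier) → Enumerates R P h → P ⊆ Ix R x →
    (∀ {y z} → y ≈ z → P y → P z) → ∀ i (B : Fin m → Bool) →
    (∀ {j} → B j ≡ true → P (e i - e j)) → (∀ {j} → P (e i - e j) → B j ≡ true) →
    ∑[ j < m ] 𝟙 (B j) ≡ + c
  count-row {c} h h-enum P⊆Ix P-resp i B B⇒P P⇒B = count-bijection B φ B∘φ φ-injective φ-onto
    where
    module H = Enumerates h-enum
    φ : Fin c → Fin m
    φ k = proj₁ (E.surjective (e i - h k) (Ix-sub (E.inP i) (P⊆Ix (H.inP k))))
    eφ : ∀ k → e (φ k) ≈ e i - h k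
    eφ k = proj₂ (E.surjective (e i - h k) (Ix-sub (E.inP i) (P⊆Ix (H.inP k))))
    h≈ : ∀ k → e i - e (φ k) ≈ h k
    h≈ k = ≈.trans (+-congˡ (-‿cong (eφ k))) (x-[x-y]≈y (e i) (h k))
    B∘φ : ∀ k → B (φ k) ≡ true
    B∘φ k = P⇒B (P-resp (≈.sym (h≈ k)) (H.inP k))
    φ-injective : Injective _≡_ _≡_ φ
    φ-injective {k} {k′} φk≡φk′ =
      H.injective k k′ (≈.trans (≈.sym (h≈ k))
        (≈.trans (≈.reflexive (cong (λ j → e i - e j) φk≡φk′)) (h≈ k′)))
    φ-onto : ∀ j → B j ≡ true → ∃ λ k → φ k ≡ j
    φ-onto j Bj = let k , hk≈ = H.surjective (e i - e j) (B⇒P Bj) in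
      k , E.injective (φ k) j (≈.trans (eφ k) (≈.trans (+-congˡ (-‿cong hk≈)) (x-[x-y]≈y (e i) (e j))))

  classSize : ∀ i → ∑[ j < m ] 𝟙 (S i j) ≡ + b
  classSize i = count-row g g-enum proj₁ Mx-resp i (S i) S⇒Mx Mx⇒S

  degree : ∀ i → ∑[ j < m ] 𝟙 (not (S i j)) ≡ + a
  degree i = count-row f f-enum (λ (u , _ , y≈xu) → u , y≈xu) xR*-resp i (not ∘ S i) not-S⇒adjacent adjacent⇒not-S

  origin : Fin m
  origin = proj₁ (E.surjective 0# (proj₁ Mx-0))

  m∸b≡a : m ∸ b ≡ a
  m∸b≡a = trans (cong (_∸ b) m≡a+b) (m+n∸n≡m a b)
    where
    𝟙+𝟙not : ∀ s → + 1 ≡ 𝟙 (not s) ℤ.+ 𝟙 s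
    𝟙+𝟙not true  = refl
    𝟙+𝟙not false = refl
    m≡a+b : m ≡ a ℕ.+ b
    m≡a+b = +-injective (begin
      + m
        ≡⟨ sum-ones m ⟨
      ∑[ j < m ] (+ 1)
        ≡⟨ sum-cong-≗ (λ j → 𝟙+𝟙not (S origin j)) ⟩
      ∑[ j < m ] (𝟙 (not (S origin j)) ℤ.+ 𝟙 (S origin j))
        ≡⟨ ∑-distrib-+ (λ j → 𝟙 (not (S origin j))) (λ j → 𝟙 (S origin j)) ⟩
      ∑[ j < m ] 𝟙 (not (S origin j)) ℤ.+ ∑[ j < m ] 𝟙 (S origin j)
        ≡⟨ cong₂ ℤ._+_ (degree origin) (classSize origin) ⟩
      + a ℤ.+ + b
        ≡⟨ pos-+ a b ⟨
      + (a ℕ.+ b)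
        ∎)
      where open ≡.≡-Reasoning

lemma3p4 : (R : CommutativeRing 0ℓ 0ℓ) → IsFiniteRing R → IsLocalRing R →
    (x : CommutativeRing.Carrier R) → ¬ CommutativeRing._≈_ R x (CommutativeRing.0# R) →
    (m : ℕ) (e : Fin m → CommutativeRing.Carrier R) → Enumerates R (Ix R x) e →
    (a : ℕ) (f : Fin a → CommutativeRing.Carrier R) → Enumerates R (xR* R x) f →
    (b : ℕ) (g : Fin b → CommutativeRing.Carrier R) → Enumerates R (Mx R x) g →
    (A : Matrix m) → IsAdjacencyMatrix (λ i j → CayAdj R x (e i) (e j)) A →
    Σ ℕ λ q → m ≡ q ℕ.* b ×
      (∀ (t : ℤ) → charPoly m A t ≡
        (t ℤ.- + a) ℤ.* ((t ℤ.+ + b) ℤ.^ (q ∸ 1) ℤ.* t ℤ.^ (q ℕ.* (b ∸ 1))))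
lemma3p4 R finite local x x≉0 m e e-enum a f f-enum b g g-enum A A-adj =
  let q , m≡q*b , charPoly≡ = charPoly-completeMultipartite A S S-isBoolEquivalence classSize A≡𝟙[not-S] origin
  in  q , m≡q*b , λ t → trans (charPoly≡ t)
        (cong (λ d → (t ℤ.- + d) ℤ.* ((t ℤ.+ + b) ℤ.^ (q ∸ 1) ℤ.* t ℤ.^ (q ℕ.* (b ∸ 1)))) m∸b≡a)
  where
  open CayleyGraph R finite local x x≉0 e e-enum f f-enum g g-enum A A-adj
  open ClassMatrix using (charPoly-completeMultipartite)
  open import Data.Product using (_,_)
  open import Relation.Binary.PropositionalEquality using (trans; cong)
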